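{- Let $k\ge1$, $\pi\in S_k$, $j\in[k]$, and let $p=(\pi,R)$ with $R=([k]\setminus\{j\})\times[k]$ (all columns of boxes shaded except column $j$, which is fully unshaded). Then for every $n\ge k$, \[ s_n^+(p)=\frac{n!}{k!}\qquad\text{and}\qquad \frac{s_n^+(p)}{n!}=\frac1{k!}. \]
   Context: For $n\ge1$, $S_n$ is the set of permutations of $\{1,\dots,n\}$ in one-line notation $\tau=\tau_1\cdots\tau_n$. For an integer $k\ge0$ write $[k]=\{0,1,\dots,k\}$. A mesh pattern of length $k$ is a pair $(\pi,R)$ with $\pi\in S_k$ and $R\subseteq[k]\times[k]$; the elements $(x,y)\in R$ are the shaded boxes (box $(x,y)$ is the unit square with south-west corner $(x,y)$ in the plot of the points $(i,\pi_i)$); row $y$ of boxes is $[k]\times\{y\}$ and column $x$ is $\{x\}\times[k]$. An occurrence of $(\pi,R)$ in $\tau\in S_n$ is a choice of positions $i_1<\dots<i_k$ such that $\tau_{i_a}<\tau_{i_b}$ iff $\pi_a<\pi_b$ for all $a,b$, and such that for every $(x,y)\in R$ there is no index $m$ with $i_x<m<i_{x+1}$ and $v_y<\tau_m<v_{y+1}$, where $i_0=0$, $i_{k+1}=n+1$, $v_0=0$, $v_{k+1}=n+1$, and for $1\le y\le k$, $v_y$ is the $y$-th smallest of the values $\tau_{i_1},\dots,\tau_{i_k}$. A permutation contains a mesh pattern if it has at least one occurrence of it, and $s_n^+(p)$ denotes the number of permutations in $S_n$ containing $p$. -}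

module Defs where

open import Data.Nat using (ℕ; zero; suc; _<_; _≤_)
open import Data.Fin using (Fin; toℕ)
open import Data.Vec using (Vec; lookup)
open import Data.List using (List; length)
open import Data.List.Membership.Propositional using (_∈_)
open import Data.List.Relation.Unary.Unique.Propositional using (Unique)
open import Data.Product using (Σ; ∃; _×_)
open import Data.Sum using (_⊎_)
open import Relation.Binary.PropositionalEquality using (_≡_; _≢_)
open import Relation.Nullary using (¬_)
open import Function.Bundles using (_⇔_)

-- A permutation of {1..n} in one-line notation, stored 0-indexed:
-- τ_i (1-indexed) = 1 + toℕ (lookup τ (i-1)).
IsPerm : ∀ {n} → Vec (Fin n) n → Set
IsPerm {n} τ = ∀ (a b : Fin n) → lookup τ a ≡ lookup τ b → a ≡ b

val : ∀ {n} → Vec (Fin n) n → Fin n → ℕ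
val τ m = suc (toℕ (lookup τ m))

record MeshPattern (k : ℕ) : Set₁ where
  field
    pat     : Vec (Fin k) k
    shaded  : ℕ → ℕ → Set

-- An occurrence candidate: positions i_1 < ... < i_k (0-indexed Fin n)
module _ {k n : ℕ} (p : MeshPattern k) (τ : Vec (Fin n) n) (i : Fin k → Fin n) where
  open MeshPattern p

  pos : Fin k → ℕ
  pos a = suc (toℕ (i a))

  ov : Fin k → ℕ
  ov a = val τ (i a)

  -- i_x (left boundary of column x), with i_0 = 0
  LeftPos : ℕ → ℕ → Set
  LeftPos x q = (x ≡ 0 × q ≡ 0) ⊎ (∃ λ (a : Fin k) → suc (toℕ a) ≡ x × q ≡ pos a)

  -- i_{x+1} (right boundary of column x), with i_{k+1} = n+1
  RightPos : ℕ → ℕ → Set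
  RightPos x q = (x ≡ k × q ≡ suc n) ⊎ (∃ λ (a : Fin k) → toℕ a ≡ x × q ≡ pos a)

  -- v_y (lower boundary of row y), v_0 = 0, and v_y for y ≥ 1 is the y-th
  -- smallest occurrence value, i.e. τ_{i_a} where π_a = y
  -- (valid as the occurrence is order-isomorphic to π)
  LowerVal : ℕ → ℕ → Set
  LowerVal y v = (y ≡ 0 × v ≡ 0) ⊎ (∃ λ (a : Fin k) → suc (toℕ (lookup pat a)) ≡ y × v ≡ ov a)

  -- v_{y+1} (upper boundary of row y), v_{k+1} = n+1
  UpperVal : ℕ → ℕ → Set
  UpperVal y v = (y ≡ k × v ≡ suc n) ⊎ (∃ λ (a : Fin k) → toℕ (lookup pat a) ≡ y × v ≡ ov a)

  PointInBox : ℕ → ℕ → Set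
  PointInBox x y = ∃ λ (m : Fin n) → ∃ λ l → ∃ λ r → ∃ λ lo → ∃ λ hi →
      LeftPos x l × RightPos x r × LowerVal y lo × UpperVal y hi ×
      l < suc (toℕ m) × suc (toℕ m) < r × lo < val τ m × val τ m < hi

  IsOccurrence : Set
  IsOccurrence =
      (∀ (a b : Fin k) → toℕ a < toℕ b → toℕ (i a) < toℕ (i b))
    × (∀ (a b : Fin k) → (ov a < ov b → toℕ (lookup pat a) < toℕ (lookup pat b))
                       × (toℕ (lookup pat a) < toℕ (lookup pat b) → ov a < ov b))
    × (∀ x y → shaded x y → ¬ PointInBox x y)

Contains : ∀ {k n} → MeshPattern k → Vec (Fin n) n → Set
Contains {k} {n} p τ = ∃ λ (i : Fin k → Fin n) → IsOccurrence p τ i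

-- "s_n^+(p) = N": there is a duplicate-free list consisting exactly of the
-- permutations in S_n containing p, and it has length N.
SPlusIs : ∀ {k} → (n : ℕ) → MeshPattern k → ℕ → Set
SPlusIs n p N = Σ (List (Vec (Fin n) n)) λ L →
    Unique L × (∀ τ → (τ ∈ L) ⇔ (IsPerm τ × Contains p τ)) × length L ≡ N

allButColumn : ℕ → ℕ → ℕ → ℕ → Set
allButColumn k j x y = x ≤ k × y ≤ k × x ≢ j

colPattern : ∀ {k} → Vec (Fin k) k → ℕ → MeshPattern k
colPattern {k} π j = record { pat = π ; shaded = allButColumn k j }

-- Shading every column of boxes but column j forces an occurrence onto the fixed positions
-- 1, …, j and n − k + j + 1, …, n: a point of τ strictly inside a shaded column would lie in one
-- of its boxes. So τ contains the pattern exactly when its entries at these k positions are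
-- order-isomorphic to π. Inserting a new entry, of any of the n + 1 possible values, at position
-- j + 1 is a bijection from {0, …, n} × S_n onto S_{n+1} preserving this property, so the count is
-- multiplied by n + 1 at each step from n = k, where π is the only such permutation.
module Submission where

open import Defs
open import Data.Nat
  using (ℕ; zero; suc; _+_; _*_; _∸_; _≤_; _<_; _/_; _!; z≤n; s≤s; s≤s⁻¹; z<s; NonZero; _<?_; _≤?_;
         _≤′_; ≤′-reflexive; ≤′-step)
open import Data.Nat.Properties
open import Data.Nat.DivMod using (m*n/n≡m)
open import Data.Nat.Tactic.RingSolver using (solve-∀)
open import Data.Fin as Fin using (Fin; toℕ; fromℕ<; punchIn; punchOut)
open import Data.Fin.Properties
  using (toℕ-injective; toℕ<n; toℕ-fromℕ<; ¬Fin0; any?; pigeonhole; punchIn-injective; punchInᵢ≢i;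
         punchIn-punchOut; punchOut-injective; punchIn-mono-≤; punchIn-cancel-≤)
open import Data.Vec using (Vec; lookup; tabulate; insertAt; map)
open import Data.Vec.Properties
  using (tabulate∘lookup; tabulate-cong; lookup∘tabulate; lookup-map; insertAt-lookup; insertAt-punchIn)
open import Data.List as List using (List; []; _∷_; _++_; length; cartesianProductWith; allFin)
open import Data.List.Properties using (length-++; length-map; length-tabulate)
open import Data.List.Membership.Propositional using (_∈_)
open import Data.List.Membership.Propositional.Properties
  using (∈-cartesianProductWith⁺; ∈-cartesianProductWith⁻; ∈-allFin)
open import Data.List.Relation.Unary.Any using (here)
open import Data.List.Relation.Unary.All using ([])
open import Data.List.Relation.Unary.AllPairs using ([]; _∷_)
open import Data.List.Relation.Unary.Unique.Propositional using (Unique)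
open import Data.List.Relation.Unary.Unique.Propositional.Properties
  using (cartesianProductWith⁺; allFin⁺)
open import Data.Product using (Σ; ∃; ∃₂; _×_; _,_; proj₁; proj₂; swap)
open import Data.Sum using (inj₁; inj₂)
open import Data.Empty using (⊥-elim)
open import Function using (_∘_; case_of_)
open import Function.Bundles using (_⇔_; mk⇔; Equivalence)
open import Function.Construct.Composition using (_⇔-∘_)
open import Function.Definitions using (Injective)
open import Relation.Binary.PropositionalEquality
  using (_≡_; _≢_; refl; sym; trans; cong; cong₂; subst; subst₂; module ≡-Reasoning)
open import Relation.Binary.Definitions using (tri<; tri≈; tri>)
open import Relation.Nullary using (¬_; yes; no; contradiction)

lookup-ext : ∀ {A : Set} {n} (xs ys : Vec A n) → (∀ q → lookup xs q ≡ lookup ys q) → xs ≡ ys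
lookup-ext xs ys eq = begin
  xs                   ≡⟨ tabulate∘lookup xs ⟨
  tabulate (lookup xs) ≡⟨ tabulate-cong eq ⟩
  tabulate (lookup ys) ≡⟨ tabulate∘lookup ys ⟩
  ys                   ∎
  where open ≡-Reasoning

injective⇒surjective : ∀ {k} {f : Fin k → Fin k} → Injective _≡_ _≡_ f → ∀ t → ∃ λ b → f b ≡ t
injective⇒surjective {zero} _ ()
injective⇒surjective {suc k} {f} f-inj t with any? (λ b → f b Fin.≟ t)
... | yes hit = hit
... | no miss = ⊥-elim (collision (pigeonhole (n<1+n k) (λ b → punchOut (t≢f b))))
  where
  t≢f : ∀ b → t ≢ f b
  t≢f b t≡fb = miss (b , sym t≡fb)
  collision : ¬ ∃₂ λ a b → a Fin.< b × punchOut (t≢f a) ≡ punchOut (t≢f b)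
  collision (a , b , a<b , eq) = <⇒≢ a<b (cong toℕ (f-inj (punchOut-injective (t≢f a) (t≢f b) eq)))

injective⇒hits : ∀ {k} {f : Fin k → Fin k} → Injective _≡_ _≡_ f → ∀ t → t < k → ∃ λ b → toℕ (f b) ≡ t
injective⇒hits f-inj t t<k with b , fb≡t ← injective⇒surjective f-inj (fromℕ< t<k) =
  b , trans (cong toℕ fb≡t) (toℕ-fromℕ< t<k)

toℕ-punchIn-< : ∀ {n} (i : Fin (suc n)) (a : Fin n) → toℕ a < toℕ i → toℕ (punchIn i a) ≡ toℕ a
toℕ-punchIn-< (Fin.suc i) Fin.zero    _         = refl
toℕ-punchIn-< (Fin.suc i) (Fin.suc a) (s≤s a<i) = cong suc (toℕ-punchIn-< i a a<i)

toℕ-punchIn-≥ : ∀ {n} (i : Fin (suc n)) (a : Fin n) → toℕ i ≤ toℕ a → toℕ (punchIn i a) ≡ suc (toℕ a)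
toℕ-punchIn-≥ Fin.zero    a           _         = refl
toℕ-punchIn-≥ (Fin.suc i) (Fin.suc a) (s≤s i≤a) = cong suc (toℕ-punchIn-≥ i a i≤a)

punchIn-mono-< : ∀ {n} (i : Fin (suc n)) (a b : Fin n) → a Fin.< b → punchIn i a Fin.< punchIn i b
punchIn-mono-< i a b a<b = ≰⇒> (λ ib≤ia → <⇒≱ a<b (punchIn-cancel-≤ i b a ib≤ia))

punchIn-cancel-< : ∀ {n} (i : Fin (suc n)) (a b : Fin n) → punchIn i a Fin.< punchIn i b → a Fin.< b
punchIn-cancel-< i a b ia<ib = ≰⇒> (λ b≤a → <⇒≱ ia<ib (punchIn-mono-≤ i b a b≤a))

length-cartesianProductWith : ∀ {A B C : Set} (f : A → B → C) (xs : List A) (ys : List B) →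
  length (cartesianProductWith f xs ys) ≡ length xs * length ys
length-cartesianProductWith f []       ys = refl
length-cartesianProductWith f (x ∷ xs) ys = begin
  length (List.map (f x) ys ++ cartesianProductWith f xs ys)
    ≡⟨ length-++ (List.map (f x) ys) ⟩
  length (List.map (f x) ys) + length (cartesianProductWith f xs ys)
    ≡⟨ cong₂ _+_ (length-map (f x) ys) (length-cartesianProductWith f xs ys) ⟩
  length ys + length xs * length ys
    ∎
  where open ≡-Reasoning

right-offset : ∀ {x y d n k} → k ≤ n → suc x + d ≡ n → suc y + d ≡ k → x ≡ y + (n ∸ k)
right-offset {x} {y} {d} {n} {k} k≤n x-end y-end = +-cancelʳ-≡ k x (y + (n ∸ k)) (begin
  x + k                 ≡⟨ cong (x +_) y-end ⟨
  x + (suc y + d)       ≡⟨ interchange x y d ⟩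
  y + (suc x + d)       ≡⟨ cong (y +_) x-end ⟩
  y + n                 ≡⟨ cong (y +_) (m∸n+n≡m k≤n) ⟨
  y + (n ∸ k + k)       ≡⟨ +-assoc y (n ∸ k) k ⟨
  y + (n ∸ k) + k       ∎)
  where
  open ≡-Reasoning
  interchange : ∀ x y d → x + (suc y + d) ≡ y + (suc x + d)
  interchange = solve-∀

OrderIsomorphic : ∀ {k} → (Fin k → ℕ) → (Fin k → ℕ) → Set
OrderIsomorphic f g = ∀ a b → (f a < f b → g a < g b) × (g a < g b → f a < f b)

OrderIsomorphic-sym : ∀ {k} {f g : Fin k → ℕ} → OrderIsomorphic f g → OrderIsomorphic g f
OrderIsomorphic-sym f≅g a b = swap (f≅g a b)

OrderIsomorphic-trans : ∀ {k} {f g h : Fin k → ℕ} →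
  OrderIsomorphic f g → OrderIsomorphic g h → OrderIsomorphic f h
OrderIsomorphic-trans f≅g g≅h a b =
  proj₁ (g≅h a b) ∘ proj₁ (f≅g a b) , proj₂ (f≅g a b) ∘ proj₂ (g≅h a b)

≗⇒OrderIsomorphic : ∀ {k} {f g : Fin k → ℕ} → (∀ a → f a ≡ g a) → OrderIsomorphic f g
≗⇒OrderIsomorphic f≗g a b rewrite f≗g a | f≗g b = (λ lt → lt) , (λ lt → lt)

OrderIsomorphic-suc : ∀ {k} (f : Fin k → ℕ) → OrderIsomorphic f (suc ∘ f)
OrderIsomorphic-suc f a b = s≤s , s≤s⁻¹

order-preserving-injective⇒≥ : ∀ {k} {f g : Fin k → Fin k} → Injective _≡_ _≡_ g →
  (∀ a b → g a Fin.< g b → f a Fin.< f b) → ∀ a → g a Fin.≤ f a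
order-preserving-injective⇒≥ {k} {f} {g} g-inj g<⇒f< a = go (toℕ (g a)) a refl
  where
  go : ∀ t a → toℕ (g a) ≡ t → t ≤ toℕ (f a)
  go zero    a _        = z≤n
  go (suc t) a ga≡1+t
    with b , gb≡t ← injective⇒hits g-inj t (<-trans (n<1+n t) (subst (_< k) ga≡1+t (toℕ<n (g a)))) =
    ≤-trans (s≤s (go t b gb≡t)) (g<⇒f< b a (subst₂ _<_ (sym gb≡t) (sym ga≡1+t) (n<1+n t)))

OrderIsomorphic⇒≡ : ∀ {k} (τ σ : Vec (Fin k) k) → IsPerm τ → IsPerm σ →
  OrderIsomorphic (toℕ ∘ lookup τ) (toℕ ∘ lookup σ) → τ ≡ σ
OrderIsomorphic⇒≡ τ σ τ-perm σ-perm τ≅σ = lookup-ext τ σ λ a → toℕ-injective (≤-antisym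
  (order-preserving-injective⇒≥ (τ-perm _ _) (λ x y → proj₁ (τ≅σ x y)) a)
  (order-preserving-injective⇒≥ (σ-perm _ _) (λ x y → proj₂ (τ≅σ x y)) a))

module EmptyColumn {k n} (p : MeshPattern k) (pat-perm : IsPerm (MeshPattern.pat p))
  (τ : Vec (Fin n) n) (τ-perm : IsPerm τ) (i : Fin k → Fin n)
  (i-increasing : ∀ a b → toℕ a < toℕ b → toℕ (i a) < toℕ (i b)) where

  i-reflects-< : ∀ a b → toℕ (i a) < toℕ (i b) → toℕ a < toℕ b
  i-reflects-< a b ia<ib with <-cmp (toℕ a) (toℕ b)
  ... | tri< a<b _ _ = a<b
  ... | tri≈ _ a≡b _ = ⊥-elim (<-irrefl (cong (toℕ ∘ i) (toℕ-injective a≡b)) ia<ib)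
  ... | tri> _ _ b<a = ⊥-elim (<-asym ia<ib (i-increasing b a b<a))

  RightPos-≤ : ∀ {x r} → RightPos p τ i x r → r ≤ suc n
  RightPos-≤ (inj₁ (_ , refl))     = ≤-refl
  RightPos-≤ (inj₂ (a , _ , refl)) = s≤s (<⇒≤ (toℕ<n (i a)))

  inside-column⇒unoccupied : ∀ {x l r} (m : Fin n) → LeftPos p τ i x l → RightPos p τ i x r →
    l < suc (toℕ m) → suc (toℕ m) < r → ∀ a → m ≢ i a
  inside-column⇒unoccupied m (inj₁ (refl , refl)) (inj₁ (0≡k , refl)) _ _ a _ =
    ¬Fin0 (subst Fin (sym 0≡k) a)
  inside-column⇒unoccupied m (inj₁ (refl , refl)) (inj₂ (b , b≡0 , refl)) _ m<r a refl =
    n≮0 (subst (toℕ a <_) b≡0 (i-reflects-< a b (s≤s⁻¹ m<r)))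
  inside-column⇒unoccupied m (inj₂ (b , 1+b≡x , refl)) (inj₁ (x≡k , refl)) l<m _ a refl =
    <⇒≱ (toℕ<n a) (subst (_≤ toℕ a) (trans 1+b≡x x≡k) (i-reflects-< b a (s≤s⁻¹ l<m)))
  inside-column⇒unoccupied m (inj₂ (b , 1+b≡x , refl)) (inj₂ (b′ , b′≡x , refl)) l<m m<r a refl =
    <⇒≱ (i-reflects-< a b′ (s≤s⁻¹ m<r))
        (subst (_≤ toℕ a) (trans 1+b≡x (sym b′≡x)) (i-reflects-< b a (s≤s⁻¹ l<m)))

  InsideRow : ℕ → Set
  InsideRow w = ∃ λ y → y ≤ k × ∃ λ lo → ∃ λ hi →
    LowerVal p τ i y lo × UpperVal p τ i y hi × lo < w × w < hi

  inside-some-row : ∀ w → (∀ a → w ≢ ov p τ i a) → w < suc n →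
    ∀ d t lo → t + d ≡ k → LowerVal p τ i t lo → lo < w → InsideRow w
  inside-some-row w w≢ov w≤n zero t lo t+0≡k lower lo<w =
    t , ≤-reflexive t≡k , lo , suc n , lower , inj₁ (t≡k , refl) , lo<w , w≤n
    where
    t≡k : t ≡ k
    t≡k = trans (sym (+-identityʳ t)) t+0≡k
  inside-some-row w w≢ov w≤n (suc d) t lo t+1+d≡k lower lo<w
    with b , πb≡t ← injective⇒hits (pat-perm _ _) t (subst (t <_) t+1+d≡k (m<m+n t z<s))
       | <-cmp w (ov p τ i b)
  ... | tri< w<ov _ _ = t , subst (t ≤_) t+1+d≡k (m≤m+n t _) , lo , ov p τ i b ,
                        lower , inj₂ (b , πb≡t , refl) , lo<w , w<ov
  ... | tri≈ _ w≡ov _ = ⊥-elim (w≢ov b w≡ov)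
  ... | tri> _ _ ov<w = inside-some-row w w≢ov w≤n d (suc t) (ov p τ i b)
                          (trans (sym (+-suc t d)) t+1+d≡k) (inj₂ (b , cong suc πb≡t , refl)) ov<w

  inside-column⇒inside-box : ∀ {x l r} (m : Fin n) → LeftPos p τ i x l → RightPos p τ i x r →
    l < suc (toℕ m) → suc (toℕ m) < r → ∃ λ y → y ≤ k × PointInBox p τ i x y
  inside-column⇒inside-box {x} {l} {r} m left right l<m m<r =
    case inside-some-row (val τ m) val-unoccupied (s≤s (toℕ<n (lookup τ m)))
                         k 0 0 refl (inj₁ (refl , refl)) z<s of λ
      { (y , y≤k , lo , hi , lower , upper , lo<w , w<hi) →
          y , y≤k , m , l , r , lo , hi , left , right , lower , upper , l<m , m<r , lo<w , w<hi }
    where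
    val-unoccupied : ∀ a → val τ m ≢ ov p τ i a
    val-unoccupied a eq = inside-column⇒unoccupied m left right l<m m<r a
      (τ-perm m (i a) (toℕ-injective (suc-injective eq)))

  empty-column : ∀ {x l r} → (∀ y → y ≤ k → ¬ PointInBox p τ i x y) →
    LeftPos p τ i x l → RightPos p τ i x r → r ≤ suc l
  empty-column {x} {l} {r} empty left right with r ≤? suc l
  ... | yes r≤1+l = r≤1+l
  ... | no  r≰1+l = case inside-column⇒inside-box m left right l<m m<r of λ
      { (y , y≤k , box) → ⊥-elim (empty y y≤k box) }
    where
    l<n : l < n
    l<n = s≤s⁻¹ (≤-trans (≰⇒> r≰1+l) (RightPos-≤ right))
    m : Fin n
    m = fromℕ< l<n
    l<m : l < suc (toℕ m)
    l<m = subst (λ z → l < suc z) (sym (toℕ-fromℕ< l<n)) ≤-refl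
    m<r : suc (toℕ m) < r
    m<r = subst (λ z → suc z < r) (sym (toℕ-fromℕ< l<n)) (≰⇒> r≰1+l)

Enumerates : ∀ {n} → List (Vec (Fin n) n) → (Vec (Fin n) n → Set) → Set
Enumerates L P = Unique L × (∀ τ → τ ∈ L ⇔ (IsPerm τ × P τ))

module Insertion {n} (J : Fin (suc n)) where

  insert : Fin (suc n) → Vec (Fin n) n → Vec (Fin (suc n)) (suc n)
  insert v τ = insertAt (map (punchIn v) τ) J v

  lookup-insert-J : ∀ v τ → lookup (insert v τ) J ≡ v
  lookup-insert-J v τ = insertAt-lookup (map (punchIn v) τ) J v

  lookup-insert-punchIn : ∀ v τ q → lookup (insert v τ) (punchIn J q) ≡ punchIn v (lookup τ q)
  lookup-insert-punchIn v τ q =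
    trans (insertAt-punchIn (map (punchIn v) τ) J v q) (lookup-map q (punchIn v) τ)

  data Position : Fin (suc n) → Set where
    at-J    : Position J
    punched : ∀ q → Position (punchIn J q)

  position : ∀ q → Position q
  position q with J Fin.≟ q
  ... | yes refl = at-J
  ... | no  J≢q  = subst Position (punchIn-punchOut J≢q) (punched (punchOut J≢q))

  insert-perm : ∀ v τ → IsPerm τ → IsPerm (insert v τ)
  insert-perm v τ τ-perm q q′ = go (position q) (position q′)
    where
    go : ∀ {q q′} → Position q → Position q′ → lookup (insert v τ) q ≡ lookup (insert v τ) q′ → q ≡ q′
    go at-J        at-J         _  = refl
    go at-J        (punched q′) eq = ⊥-elim (punchInᵢ≢i v (lookup τ q′)
      (trans (sym (lookup-insert-punchIn v τ q′)) (trans (sym eq) (lookup-insert-J v τ))))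
    go (punched q) at-J         eq = ⊥-elim (punchInᵢ≢i v (lookup τ q)
      (trans (sym (lookup-insert-punchIn v τ q)) (trans eq (lookup-insert-J v τ))))
    go (punched q) (punched q′) eq = cong (punchIn J) (τ-perm q q′ (punchIn-injective v _ _
      (trans (sym (lookup-insert-punchIn v τ q)) (trans eq (lookup-insert-punchIn v τ q′)))))

  insert-injective : ∀ {v w τ σ} → insert v τ ≡ insert w σ → v ≡ w × τ ≡ σ
  insert-injective {v} {w} {τ} {σ} eq = v≡w , lookup-ext τ σ λ q → punchIn-injective v _ _ (begin
      punchIn v (lookup τ q)             ≡⟨ lookup-insert-punchIn v τ q ⟨
      lookup (insert v τ) (punchIn J q)  ≡⟨ cong (λ ρ → lookup ρ (punchIn J q)) eq ⟩
      lookup (insert w σ) (punchIn J q)  ≡⟨ lookup-insert-punchIn w σ q ⟩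
      punchIn w (lookup σ q)             ≡⟨ cong (λ u → punchIn u (lookup σ q)) v≡w ⟨
      punchIn v (lookup σ q)             ∎)
    where
    open ≡-Reasoning
    v≡w : v ≡ w
    v≡w = trans (sym (lookup-insert-J v τ)) (trans (cong (λ ρ → lookup ρ J) eq) (lookup-insert-J w σ))

  insert-surjective : ∀ τ′ → IsPerm τ′ → ∃₂ λ v τ → IsPerm τ × insert v τ ≡ τ′
  insert-surjective τ′ τ′-perm = v , τ , τ-perm , lookup-ext _ _ (λ q → go (position q))
    where
    v : Fin (suc n)
    v = lookup τ′ J
    v≢ : ∀ q → v ≢ lookup τ′ (punchIn J q)
    v≢ q eq = punchInᵢ≢i J q (sym (τ′-perm J (punchIn J q) eq))
    τ : Vec (Fin n) n
    τ = tabulate (λ q → punchOut (v≢ q))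
    lookup-τ : ∀ q → lookup τ q ≡ punchOut (v≢ q)
    lookup-τ = lookup∘tabulate (λ q → punchOut (v≢ q))
    τ-perm : IsPerm τ
    τ-perm a b eq = punchIn-injective J a b (τ′-perm _ _ (punchOut-injective (v≢ a) (v≢ b)
      (trans (sym (lookup-τ a)) (trans eq (lookup-τ b)))))
    go : ∀ {q} → Position q → lookup (insert v τ) q ≡ lookup τ′ q
    go at-J        = lookup-insert-J v τ
    go (punched q) = begin
      lookup (insert v τ) (punchIn J q)  ≡⟨ lookup-insert-punchIn v τ q ⟩
      punchIn v (lookup τ q)             ≡⟨ cong (punchIn v) (lookup-τ q) ⟩
      punchIn v (punchOut (v≢ q))        ≡⟨ punchIn-punchOut (v≢ q) ⟩
      lookup τ′ (punchIn J q)            ∎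
      where open ≡-Reasoning

  insert-OrderIsomorphic : ∀ {k} v τ (s : Fin k → Fin n) →
    OrderIsomorphic (λ a → val (insert v τ) (punchIn J (s a))) (λ a → val τ (s a))
  insert-OrderIsomorphic v τ s a b
    rewrite lookup-insert-punchIn v τ (s a) | lookup-insert-punchIn v τ (s b) =
      (λ lt → s≤s (punchIn-cancel-< v _ _ (s≤s⁻¹ lt))) ,
      (λ lt → s≤s (punchIn-mono-< v _ _ (s≤s⁻¹ lt)))

  insertAll : List (Vec (Fin n) n) → List (Vec (Fin (suc n)) (suc n))
  insertAll = cartesianProductWith insert (allFin (suc n))

  length-insertAll : ∀ L → length (insertAll L) ≡ suc n * length L
  length-insertAll L = trans (length-cartesianProductWith insert (allFin (suc n)) L)
                             (cong (_* length L) (length-tabulate {n = suc n} (λ v → v)))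

  insertAll-enumerates : ∀ {P P′} {L} → (∀ v τ → P′ (insert v τ) ⇔ P τ) → Enumerates L P →
    Enumerates (insertAll L) P′
  insertAll-enumerates {P} {P′} {L} P′⇔P (unique , members) =
    cartesianProductWith⁺ insert insert-injective (allFin⁺ (suc n)) unique , λ τ′ → mk⇔ (to τ′) (from τ′)
    where
    to : ∀ τ′ → τ′ ∈ insertAll L → IsPerm τ′ × P′ τ′
    to τ′ τ′∈ with v , τ , _ , τ∈ , refl ← ∈-cartesianProductWith⁻ insert (allFin (suc n)) L τ′∈
      with τ-perm , Pτ ← Equivalence.to (members τ) τ∈ =
      insert-perm v τ τ-perm , Equivalence.from (P′⇔P v τ) Pτ
    from : ∀ τ′ → IsPerm τ′ × P′ τ′ → τ′ ∈ insertAll L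
    from τ′ (τ′-perm , P′τ′) with v , τ , τ-perm , refl ← insert-surjective τ′ τ′-perm =
      ∈-cartesianProductWith⁺ insert (∈-allFin v)
        (Equivalence.from (members τ) (τ-perm , Equivalence.to (P′⇔P v τ) P′τ′))

module Slots {k} (j : ℕ) (j≤k : j ≤ k) where

  -- Entries 0 … j − 1 fill the first j places and entries j … k − 1 the last k − j of n places.
  slotℕ : ℕ → Fin k → ℕ
  slotℕ n a with toℕ a <? j
  ... | yes _ = toℕ a
  ... | no  _ = toℕ a + (n ∸ k)

  slotℕ-left : ∀ n a → toℕ a < j → slotℕ n a ≡ toℕ a
  slotℕ-left n a a<j with toℕ a <? j
  ... | yes _   = refl
  ... | no  a≮j = contradiction a<j a≮j

  slotℕ-right : ∀ n a → j ≤ toℕ a → slotℕ n a ≡ toℕ a + (n ∸ k)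
  slotℕ-right n a j≤a with toℕ a <? j
  ... | yes a<j = contradiction j≤a (<⇒≱ a<j)
  ... | no  _   = refl

  slotℕ-increasing : ∀ n a b → toℕ a < toℕ b → slotℕ n a < slotℕ n b
  slotℕ-increasing n a b a<b with toℕ a <? j | toℕ b <? j
  ... | yes _   | yes _ = a<b
  ... | yes _   | no  _ = <-≤-trans a<b (m≤m+n _ _)
  ... | no  a≮j | yes b<j = contradiction (<-trans a<b b<j) a≮j
  ... | no  _   | no  _ = +-monoˡ-< _ a<b

  slotℕ<n : ∀ {n} → k ≤ n → ∀ a → slotℕ n a < n
  slotℕ<n {n} k≤n a with toℕ a <? j
  ... | yes _ = <-≤-trans (toℕ<n a) k≤n
  ... | no  _ = subst (toℕ a + (n ∸ k) <_) (m+[n∸m]≡n k≤n) (+-monoˡ-< (n ∸ k) (toℕ<n a))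

  slot : ∀ {n} → .(k ≤ n) → Fin k → Fin n
  slot k≤n a = fromℕ< (slotℕ<n k≤n a)

  toℕ-slot : ∀ {n} .(k≤n : k ≤ n) a → toℕ (slot k≤n a) ≡ slotℕ n a
  toℕ-slot k≤n a = toℕ-fromℕ< (slotℕ<n k≤n a)

  -- The positions q of an occurrence leave every column of boxes but column j empty.
  record Packed (n : ℕ) (q : Fin k → ℕ) : Set where
    field
      starts-at-0 : ∀ a → toℕ a ≡ 0 → 0 ≢ j → q a ≡ 0
      consecutive : ∀ a b → toℕ b ≡ suc (toℕ a) → suc (toℕ a) ≢ j → q b ≡ suc (q a)
      ends-at-n   : ∀ a → suc (toℕ a) ≡ k → k ≢ j → suc (q a) ≡ n

  slotℕ-packed : ∀ {n} → k ≤ n → Packed n (slotℕ n)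
  slotℕ-packed {n} k≤n = record
    { starts-at-0 = λ a a≡0 0≢j →
        trans (slotℕ-left n a (subst (_< j) (sym a≡0) (n≢0⇒n>0 (0≢j ∘ sym)))) a≡0
    ; consecutive = consecutive
    ; ends-at-n   = ends-at-n
    }
    where
    consecutive : ∀ a b → toℕ b ≡ suc (toℕ a) → suc (toℕ a) ≢ j → slotℕ n b ≡ suc (slotℕ n a)
    consecutive a b b≡1+a 1+a≢j with suc (toℕ a) <? j
    ... | yes 1+a<j = begin
      slotℕ n b         ≡⟨ slotℕ-left n b (subst (_< j) (sym b≡1+a) 1+a<j) ⟩
      toℕ b             ≡⟨ b≡1+a ⟩
      suc (toℕ a)       ≡⟨ cong suc (slotℕ-left n a (<-trans (n<1+n _) 1+a<j)) ⟨
      suc (slotℕ n a)   ∎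
      where open ≡-Reasoning
    ... | no 1+a≮j = begin
      slotℕ n b                   ≡⟨ slotℕ-right n b (subst (j ≤_) (sym b≡1+a) (m≤n⇒m≤1+n j≤a)) ⟩
      toℕ b + (n ∸ k)             ≡⟨ cong (_+ (n ∸ k)) b≡1+a ⟩
      suc (toℕ a + (n ∸ k))       ≡⟨ cong suc (slotℕ-right n a j≤a) ⟨
      suc (slotℕ n a)             ∎
      where
      open ≡-Reasoning
      j≤a : j ≤ toℕ a
      j≤a = s≤s⁻¹ (≤∧≢⇒< (≮⇒≥ 1+a≮j) (1+a≢j ∘ sym))
    ends-at-n : ∀ a → suc (toℕ a) ≡ k → k ≢ j → suc (slotℕ n a) ≡ n
    ends-at-n a 1+a≡k k≢j = begin
      suc (slotℕ n a)            ≡⟨ cong suc (slotℕ-right n a j≤a) ⟩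
      suc (toℕ a) + (n ∸ k)      ≡⟨ cong (_+ (n ∸ k)) 1+a≡k ⟩
      k + (n ∸ k)                ≡⟨ m+[n∸m]≡n k≤n ⟩
      n                          ∎
      where
      open ≡-Reasoning
      j≤a : j ≤ toℕ a
      j≤a = s≤s⁻¹ (≤∧≢⇒< (subst (j ≤_) (sym 1+a≡k) j≤k) (λ j≡1+a → k≢j (sym (trans j≡1+a 1+a≡k))))

  packed⇒≡slotℕ : ∀ {n q} → k ≤ n → Packed n q → ∀ a → q a ≡ slotℕ n a
  packed⇒≡slotℕ {n} {q} k≤n packed a with toℕ a <? j
  ... | yes a<j = left-block (toℕ a) a refl a<j
    where
    open Packed packed
    left-block : ∀ t a → toℕ a ≡ t → t < j → q a ≡ t
    left-block zero    a a≡0   0<j   = starts-at-0 a a≡0 (<⇒≢ 0<j)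
    left-block (suc t) a a≡1+t 1+t<j = begin
      q a            ≡⟨ consecutive b a (trans a≡1+t (cong suc (sym b≡t)))
                                        (<⇒≢ (subst (_< j) (cong suc (sym b≡t)) 1+t<j)) ⟩
      suc (q b)      ≡⟨ cong suc (left-block t b b≡t (<-trans (n<1+n t) 1+t<j)) ⟩
      suc t          ∎
      where
      open ≡-Reasoning
      t<k : t < k
      t<k = <-trans (n<1+n t) (subst (_< k) a≡1+t (toℕ<n a))
      b : Fin k
      b = fromℕ< t<k
      b≡t : toℕ b ≡ t
      b≡t = toℕ-fromℕ< t<k
  ... | no a≮j = right-offset k≤n (right-block (k ∸ suc (toℕ a)) a (m+[n∸m]≡n (toℕ<n a)) (≮⇒≥ a≮j))
                   (m+[n∸m]≡n (toℕ<n a))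
    where
    open Packed packed
    right-block : ∀ d a → suc (toℕ a) + d ≡ k → j ≤ toℕ a → suc (q a) + d ≡ n
    right-block zero a a+1≡k j≤a =
      trans (+-identityʳ _) (ends-at-n a (trans (sym (+-identityʳ _)) a+1≡k)
                                         (λ k≡j → <⇒≱ (toℕ<n a) (subst (_≤ toℕ a) (sym k≡j) j≤a)))
    right-block (suc d) a end j≤a = begin
      suc (q a) + suc d       ≡⟨ +-suc (suc (q a)) d ⟩
      suc (suc (q a)) + d     ≡⟨ cong (λ z → suc z + d) (consecutive a b b≡1+a (<⇒≢ (s≤s j≤a) ∘ sym)) ⟨
      suc (q b) + d           ≡⟨ right-block d b
                                   (trans (cong (λ z → suc z + d) b≡1+a) (trans (sym (+-suc _ d)) end))
                                   (subst (j ≤_) (sym b≡1+a) (m≤n⇒m≤1+n j≤a)) ⟩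
      n                       ∎
      where
      open ≡-Reasoning
      1+a<k : suc (toℕ a) < k
      1+a<k = subst (suc (toℕ a) <_) end (m<m+n _ z<s)
      b : Fin k
      b = fromℕ< 1+a<k
      b≡1+a : toℕ b ≡ suc (toℕ a)
      b≡1+a = toℕ-fromℕ< 1+a<k

  packed⇒gapless : ∀ {n} (p : MeshPattern k) (τ : Vec (Fin n) n) (i : Fin k → Fin n) →
    Packed n (toℕ ∘ i) → ∀ {x l r} → x ≢ j → LeftPos p τ i x l → RightPos p τ i x r → r ≤ suc l
  packed⇒gapless p τ i packed x≢j (inj₁ (refl , refl)) (inj₁ (0≡k , refl)) =
    contradiction (sym (n≤0⇒n≡0 (subst (j ≤_) (sym 0≡k) j≤k))) x≢j
  packed⇒gapless p τ i packed x≢j (inj₁ (refl , refl)) (inj₂ (b , b≡0 , refl)) =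
    s≤s (≤-reflexive (Packed.starts-at-0 packed b b≡0 x≢j))
  packed⇒gapless p τ i packed x≢j (inj₂ (a , 1+a≡x , refl)) (inj₁ (x≡k , refl)) =
    s≤s (≤-reflexive (sym (Packed.ends-at-n packed a (trans 1+a≡x x≡k) (x≢j ∘ trans x≡k))))
  packed⇒gapless p τ i packed x≢j (inj₂ (a , 1+a≡x , refl)) (inj₂ (b , b≡x , refl)) =
    s≤s (≤-reflexive (Packed.consecutive packed a b (trans b≡x (sym 1+a≡x)) (x≢j ∘ trans (sym 1+a≡x))))

  slotℕ-identity : ∀ a → slotℕ k a ≡ toℕ a
  slotℕ-identity a with toℕ a <? j
  ... | yes _ = refl
  ... | no  _ = trans (cong (toℕ a +_) (n∸n≡0 k)) (+-identityʳ _)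

  slot-identity : .(k≤k : k ≤ k) → ∀ a → slot k≤k a ≡ a
  slot-identity k≤k a = toℕ-injective (trans (toℕ-slot k≤k a) (slotℕ-identity a))

  slotℕ-suc : ∀ {n} → k ≤ n → (J : Fin (suc n)) → toℕ J ≡ j → ∀ (c : Fin n) a → toℕ c ≡ slotℕ n a →
    slotℕ (suc n) a ≡ toℕ (punchIn J c)
  slotℕ-suc {n} k≤n J J≡j c a c≡slot with toℕ a <? j
  ... | yes a<j = sym (trans (toℕ-punchIn-< J c (subst₂ _<_ (sym c≡slot) (sym J≡j) a<j)) c≡slot)
  ... | no  a≮j = begin
    toℕ a + (suc n ∸ k)      ≡⟨ cong (toℕ a +_) (+-∸-assoc 1 k≤n) ⟩
    toℕ a + suc (n ∸ k)      ≡⟨ +-suc (toℕ a) (n ∸ k) ⟩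
    suc (toℕ a + (n ∸ k))    ≡⟨ cong suc c≡slot ⟨
    suc (toℕ c)              ≡⟨ toℕ-punchIn-≥ J c j≤c ⟨
    toℕ (punchIn J c)        ∎
    where
    open ≡-Reasoning
    j≤c : toℕ J ≤ toℕ c
    j≤c = subst₂ _≤_ (sym J≡j) (sym c≡slot) (≤-trans (≮⇒≥ a≮j) (m≤m+n _ _))

  insertion-point : ∀ {n} → k ≤ n → Fin (suc n)
  insertion-point k≤n = fromℕ< (s≤s (≤-trans j≤k k≤n))

  slot-suc : ∀ {n} (k≤n : k ≤ n) a →
    slot (m≤n⇒m≤1+n k≤n) a ≡ punchIn (insertion-point k≤n) (slot k≤n a)
  slot-suc k≤n a = toℕ-injective (trans (toℕ-slot (m≤n⇒m≤1+n k≤n) a)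
    (slotℕ-suc k≤n (insertion-point k≤n) (toℕ-fromℕ< (s≤s (≤-trans j≤k k≤n)))
               (slot k≤n a) a (toℕ-slot k≤n a)))

  Packed-resp-≗ : ∀ {n q q′} → (∀ a → q a ≡ q′ a) → Packed n q → Packed n q′
  Packed-resp-≗ q≗q′ packed = record
    { starts-at-0 = λ a a≡0 0≢j → trans (sym (q≗q′ a)) (starts-at-0 a a≡0 0≢j)
    ; consecutive = λ a b b≡1+a 1+a≢j →
        trans (sym (q≗q′ b)) (trans (consecutive a b b≡1+a 1+a≢j) (cong suc (q≗q′ a)))
    ; ends-at-n   = λ a 1+a≡k k≢j → trans (cong suc (sym (q≗q′ a))) (ends-at-n a 1+a≡k k≢j)
    }
    where open Packed packed

  slot-packed : ∀ {n} (k≤n : k ≤ n) → Packed n (toℕ ∘ slot k≤n)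
  slot-packed k≤n = Packed-resp-≗ (sym ∘ toℕ-slot k≤n) (slotℕ-packed k≤n)

module ColumnPattern {k} (π : Vec (Fin k) k) (π-perm : IsPerm π) (j : ℕ) (j≤k : j ≤ k) where

  open Slots j j≤k

  p : MeshPattern k
  p = colPattern π j

  Matches : ∀ {n} → .(k ≤ n) → Vec (Fin n) n → Set
  Matches k≤n τ = OrderIsomorphic (λ a → val τ (slot k≤n a)) (toℕ ∘ lookup π)

  occurrence⇒packed : ∀ {n} {τ : Vec (Fin n) n} {i} → IsPerm τ → IsOccurrence p τ i → Packed n (toℕ ∘ i)
  occurrence⇒packed {n} {τ} {i} τ-perm (i-increasing , _ , shaded⇒empty) = record
    { starts-at-0 = λ a a≡0 0≢j →
        n≤0⇒n≡0 (s≤s⁻¹ (gapless z≤n 0≢j (inj₁ (refl , refl)) (inj₂ (a , a≡0 , refl))))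
    ; consecutive = λ a b b≡1+a 1+a≢j → ≤-antisym
        (s≤s⁻¹ (gapless (toℕ<n a) 1+a≢j (inj₂ (a , refl , refl)) (inj₂ (b , b≡1+a , refl))))
        (i-increasing a b (≤-reflexive (sym b≡1+a)))
    ; ends-at-n   = λ a 1+a≡k k≢j → ≤-antisym
        (toℕ<n (i a))
        (s≤s⁻¹ (gapless ≤-refl k≢j (inj₂ (a , 1+a≡k , refl)) (inj₁ (refl , refl))))
    }
    where
    open EmptyColumn p π-perm τ τ-perm i i-increasing
    gapless : ∀ {x l r} → x ≤ k → x ≢ j → LeftPos p τ i x l → RightPos p τ i x r → r ≤ suc l
    gapless x≤k x≢j = empty-column (λ y y≤k → shaded⇒empty _ y (x≤k , y≤k , x≢j))

  contains⇒matches : ∀ {n} (k≤n : k ≤ n) {τ : Vec (Fin n) n} → IsPerm τ → Contains p τ → Matches k≤n τ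
  contains⇒matches {n} k≤n {τ} τ-perm (i , occurrence) =
    OrderIsomorphic-trans (≗⇒OrderIsomorphic (cong (val τ) ∘ slot≡i)) (proj₁ (proj₂ occurrence))
    where
    slot≡i : ∀ a → slot k≤n a ≡ i a
    slot≡i a = toℕ-injective (begin
      toℕ (slot k≤n a)   ≡⟨ toℕ-slot k≤n a ⟩
      slotℕ n a          ≡⟨ packed⇒≡slotℕ k≤n (occurrence⇒packed {τ = τ} τ-perm occurrence) a ⟨
      toℕ (i a)          ∎)
      where open ≡-Reasoning

  matches⇒contains : ∀ {n} (k≤n : k ≤ n) {τ : Vec (Fin n) n} → Matches k≤n τ → Contains p τ
  matches⇒contains {n} k≤n {τ} τ≅π = slot k≤n , increasing , τ≅π , shaded⇒empty
    where
    increasing : ∀ a b → toℕ a < toℕ b → toℕ (slot k≤n a) < toℕ (slot k≤n b)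
    increasing a b a<b =
      subst₂ _<_ (sym (toℕ-slot k≤n a)) (sym (toℕ-slot k≤n b)) (slotℕ-increasing n a b a<b)
    shaded⇒empty : ∀ x y → allButColumn k j x y → ¬ PointInBox p τ (slot k≤n) x y
    shaded⇒empty x y (_ , _ , x≢j) (m , l , r , _ , _ , left , right , _ , _ , l<m , m<r , _) =
      1+n≰n (≤-trans m<r (≤-trans (packed⇒gapless p τ (slot k≤n) (slot-packed k≤n) x≢j left right) l<m))

  perm-matches⇔perm-contains : ∀ {n} (k≤n : k ≤ n) τ →
    (IsPerm τ × Matches k≤n τ) ⇔ (IsPerm τ × Contains p τ)
  perm-matches⇔perm-contains k≤n τ = mk⇔
    (λ (τ-perm , τ≅π) → τ-perm , matches⇒contains k≤n {τ} τ≅π)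
    (λ (τ-perm , τ∋p) → τ-perm , contains⇒matches k≤n {τ} τ-perm τ∋p)

  matches⇔≡π : ∀ {τ} → IsPerm τ → Matches ≤-refl τ ⇔ τ ≡ π
  matches⇔≡π {τ} τ-perm = mk⇔
    (λ τ≅π → OrderIsomorphic⇒≡ τ π τ-perm π-perm (OrderIsomorphic-trans (values≅ τ) τ≅π))
    (λ { refl → OrderIsomorphic-sym (values≅ π) })
    where
    values≅ : ∀ σ → OrderIsomorphic (toℕ ∘ lookup σ) (λ a → val σ (slot ≤-refl a))
    values≅ σ = OrderIsomorphic-trans (OrderIsomorphic-suc (toℕ ∘ lookup σ))
                  (≗⇒OrderIsomorphic (λ a → cong (val σ) (sym (slot-identity ≤-refl a))))

  matches-insert : ∀ {n} (k≤n : k ≤ n) v τ →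
    Matches (m≤n⇒m≤1+n k≤n) (Insertion.insert (insertion-point k≤n) v τ) ⇔ Matches k≤n τ
  matches-insert k≤n v τ = mk⇔ (OrderIsomorphic-trans (OrderIsomorphic-sym values≅))
                               (OrderIsomorphic-trans values≅)
    where
    open Insertion (insertion-point k≤n)
    values≅ : OrderIsomorphic (λ a → val (insert v τ) (slot (m≤n⇒m≤1+n k≤n) a))
                              (λ a → val τ (slot k≤n a))
    values≅ = OrderIsomorphic-trans (≗⇒OrderIsomorphic (cong (val (insert v τ)) ∘ slot-suc k≤n))
                                    (insert-OrderIsomorphic v τ (slot k≤n))

  enumerate-matches : ∀ {n} (k≤n : k ≤′ n) →
    ∃ λ L → Enumerates L (Matches (≤′⇒≤ k≤n)) × length L * k ! ≡ n !
  enumerate-matches (≤′-reflexive refl) =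
    π ∷ [] , ([] ∷ [] , members) , *-identityˡ (k !)
    where
    members : ∀ τ → τ ∈ π ∷ [] ⇔ (IsPerm τ × Matches ≤-refl τ)
    members τ = mk⇔ (λ { (here refl) → π-perm , Equivalence.from (matches⇔≡π π-perm) refl })
                    (λ (τ-perm , τ≅π) → here (Equivalence.to (matches⇔≡π τ-perm) τ≅π))
  enumerate-matches {suc n} (≤′-step k≤n) with L , enumerates , count ← enumerate-matches k≤n =
    insertAll L , insertAll-enumerates (matches-insert (≤′⇒≤ k≤n)) enumerates , (begin
      length (insertAll L) * k !   ≡⟨ cong (_* k !) (length-insertAll L) ⟩
      suc n * length L * k !       ≡⟨ *-assoc (suc n) (length L) (k !) ⟩
      suc n * (length L * k !)     ≡⟨ cong (suc n *_) count ⟩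
      suc n !                      ∎)
    where
    open Insertion (insertion-point (≤′⇒≤ k≤n))
    open ≡-Reasoning

  enumerate-containers : ∀ {n} → k ≤ n → ∃ λ L → Enumerates L (Contains p) × length L * k ! ≡ n !
  enumerate-containers k≤n with L , (unique , members) , count ← enumerate-matches (≤⇒≤′ k≤n) =
    L , (unique , λ τ → perm-matches⇔perm-contains k≤n τ ⇔-∘ members τ) , count

corollary3p3 : (k : ℕ) → 1 ≤ k → (π : Vec (Fin k) k) → IsPerm π →
    (j : ℕ) → j ≤ k → (n : ℕ) → k ≤ n →
    Σ ℕ (λ N → SPlusIs n (colPattern π j) N × N * k ! ≡ n ! × N ≡ _/_ (n !) (k !) ⦃ k !≢0 ⦄)
corollary3p3 k _ π π-perm j j≤k n k≤n
  with L , (unique , members) , count ← ColumnPattern.enumerate-containers π π-perm j j≤k k≤n =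
  length L , (L , unique , members , refl) , count , (begin
    length L                 ≡⟨ m*n/n≡m (length L) (k !) ⟨
    length L * k ! / k !     ≡⟨ cong (_/ k !) count ⟩
    n ! / k !                ∎)
  where
  open ≡-Reasoning
  instance
    k!≢0 : NonZero (k !)
    k!≢0 = k !≢0
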